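{- In the $F_4$ Black Hole Zeckendorf game: the position $(a,0,1)$ is a $P$ position for all $a\in\mathbb{Z}_{\ge0}$; the position $(a,0,2)$ is an $N$ position for all $a\in\mathbb{Z}_{\ge0}$ with $a\neq 1$; and the positions $(a,0,3)$, $(a,1,1)$ and $(a,1,2)$ are $N$ positions for all $a\in\mathbb{Z}_{\ge0}$.
   Context: The $F_4$ Black Hole Zeckendorf game: a position is a triple $(a,b,c)$ of nonnegative integers, the numbers of pieces in the columns of weights $F_1=1$, $F_2=2$, $F_3=3$. Two players alternate moves; the available moves are: (M) if $a\ge2$, go to $(a-2,b+1,c)$; (A$_1$) if $a,b\ge1$, go to $(a-1,b-1,c+1)$; (A$_2$) if $b,c\ge1$, go to $(a,b-1,c-1)$; (S$_2$) if $b\ge2$, go to $(a+1,b-2,c+1)$; (S$_3$) if $c\ge2$, go to $(a+1,b,c-2)$ (pieces landing in column $F_4=5$, the "black hole", are removed). The player making the last move wins. A position is a $P$ position if the player to move from it loses under optimal play, and an $N$ position if the player to move can force a win; positions with no move are $P$ positions. -}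

module Defs where

open import Data.Nat using (ℕ; zero; suc)
open import Data.Product using (_×_; _,_; Σ; ∃-syntax)

-- A position (a , b , c): numbers of pieces in columns of weights F1=1, F2=2, F3=3.
Pos : Set
Pos = ℕ × ℕ × ℕ

data _⟶_ : Pos → Pos → Set where
  M  : ∀ {a b c} → (suc (suc a) , b , c) ⟶ (a , suc b , c)
  A₁ : ∀ {a b c} → (suc a , suc b , c) ⟶ (a , b , suc c)
  A₂ : ∀ {a b c} → (a , suc b , suc c) ⟶ (a , b , c)
  S₂ : ∀ {a b c} → (a , suc (suc b) , c) ⟶ (suc a , b , suc c)
  S₃ : ∀ {a b c} → (a , b , suc (suc c)) ⟶ (suc a , b , c)

-- P positions (player to move loses) and N positions (player to move wins),
-- defined inductively (normal play: last mover wins; play is finite).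
mutual
  data IsP (p : Pos) : Set where
    isP : (∀ {q} → p ⟶ q → IsN q) → IsP p

  data IsN (p : Pos) : Set where
    isN : ∀ {q} → p ⟶ q → IsP q → IsN p

{-# OPTIONS --safe #-}
module Submission where

-- Along (a,0,1), (a,1,1), (a,0,0) and (a,1,0) the game is settled by a
-- simultaneous induction on a. From (a+2,0,1) the only move is M to (a,1,1),
-- which wins by A₂ into (a,0,0); that is a P position unless a = 2, and then
-- A₁ into the P position (1,0,2) wins instead. From (a+3,0,0) the only move is
-- M to (a+1,1,0), from which A₁ returns to the P position (a,0,1). Every other
-- claim is a single move into one of these P positions.

open import Defs
open import Data.Nat using (ℕ; zero; suc)
open import Data.Nat.Properties using (suc-injective)
open import Data.Product using (_×_; _,_)
open import Function using (_∘_)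
open import Relation.Binary.PropositionalEquality using (_≢_; refl)
open import Relation.Nullary using (contradiction)

200-isN : IsN (2 , 0 , 0)
200-isN = isN M (isP λ ())

102-isP : IsP (1 , 0 , 2)
102-isP = isP λ { S₃ → 200-isN }

mutual
  a01-isP : ∀ a → IsP (a , 0 , 1)
  a01-isP zero          = isP λ ()
  a01-isP (suc zero)    = isP λ ()
  a01-isP (suc (suc a)) = isP λ { M → a11-isN a }

  a11-isN : ∀ a → IsN (a , 1 , 1)
  a11-isN zero                  = isN A₂ (a00-isP 0 λ ())
  a11-isN (suc zero)            = isN A₂ (a00-isP 1 λ ())
  a11-isN (suc (suc zero))      = isN A₁ 102-isP
  a11-isN a@(suc (suc (suc _))) = isN A₂ (a00-isP a λ ())

  a00-isP : ∀ a → a ≢ 2 → IsP (a , 0 , 0)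
  a00-isP zero                _   = isP λ ()
  a00-isP (suc zero)          _   = isP λ ()
  a00-isP (suc (suc zero))    a≢2 = contradiction refl a≢2
  a00-isP (suc (suc (suc a))) _   = isP λ { M → a10-isN a }

  a10-isN : ∀ a → IsN (suc a , 1 , 0)
  a10-isN a = isN A₁ (a01-isP a)

a02-isN : ∀ a → a ≢ 1 → IsN (a , 0 , 2)
a02-isN a a≢1 = isN S₃ (a00-isP (suc a) (a≢1 ∘ suc-injective))

a03-isN : ∀ a → IsN (a , 0 , 3)
a03-isN a = isN S₃ (a01-isP (suc a))

a12-isN : ∀ a → IsN (a , 1 , 2)
a12-isN a = isN A₂ (a01-isP a)

corollary5p2 : ((a : ℕ) → IsP (a , 0 , 1))
    × ((a : ℕ) → a ≢ 1 → IsN (a , 0 , 2))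
    × ((a : ℕ) → IsN (a , 0 , 3))
    × ((a : ℕ) → IsN (a , 1 , 1))
    × ((a : ℕ) → IsN (a , 1 , 2))
corollary5p2 = a01-isP , a02-isN , a03-isN , a11-isN , a12-isN
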